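{- For $n\ge 2$, $\mathrm{thin}_{ind,prec}(CR_n)=n+1$, and $\mathrm{thin}_{ind,prec}(CR_1)=1$. The same values hold for the precedence independent proper thinness $\mathrm{pthin}_{ind,prec}(CR_n)$.
   Context: The crown graph $CR_n$ is obtained from $K_{n,n}$ by removing a perfect matching. An ordering $<$ of $V(G)$ is consistent with a partition $\mathcal{V}$ if for every $p<q<r$ with $p,q$ in the same class and $pr\in E(G)$, also $qr\in E(G)$; strongly consistent if both $<$ and its reversal are consistent. $\mathrm{thin}_{ind,prec}(G)$ (resp. $\mathrm{pthin}_{ind,prec}(G)$) is the minimum $k$ such that $V(G)$ has a partition into $k$ independent sets and an ordering consistent (resp. strongly consistent) with it in which each class is consecutive. -}

module Defs where

open import Data.Nat using (ℕ; _+_; _≤_)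
open import Data.Fin using (Fin; splitAt; _<_)
open import Data.Sum using (_⊎_; inj₁; inj₂)
open import Data.Product using (_×_; ∃)
open import Data.Empty using (⊥)
open import Relation.Nullary using (¬_)
open import Relation.Binary.PropositionalEquality using (_≡_; _≢_)
open import Function.Definitions using (Injective; Surjective)

record Graph (N : ℕ) : Set₁ where
  field
    Adj   : Fin N → Fin N → Set
    sym   : ∀ {u v} → Adj u v → Adj v u
    irrefl : ∀ {u} → ¬ Adj u u
open Graph public

-- Crown graph CR_n on Fin (n + n): vertices inj₁ i (side A) and inj₂ j (side B)
-- via splitAt; a_i b_j adjacent iff i ≢ j (K_{n,n} minus the perfect matching a_i b_i).
CRAdj' : ∀ {n} → Fin n ⊎ Fin n → Fin n ⊎ Fin n → Set
CRAdj' (inj₁ i) (inj₁ j) = ⊥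
CRAdj' (inj₁ i) (inj₂ j) = i ≢ j
CRAdj' (inj₂ i) (inj₁ j) = i ≢ j
CRAdj' (inj₂ i) (inj₂ j) = ⊥

CRsym : ∀ {n} (x y : Fin n ⊎ Fin n) → CRAdj' x y → CRAdj' y x
CRsym (inj₁ i) (inj₂ j) h e = h (Relation.Binary.PropositionalEquality.sym e)
CRsym (inj₂ i) (inj₁ j) h e = h (Relation.Binary.PropositionalEquality.sym e)

CRirr : ∀ {n} (x : Fin n ⊎ Fin n) → ¬ CRAdj' x x
CRirr (inj₁ i) ()
CRirr (inj₂ i) ()

CR : (n : ℕ) → Graph (n + n)
CR n = record
  { Adj    = λ u v → CRAdj' (splitAt n u) (splitAt n v)
  ; sym    = λ {u} {v} → CRsym (splitAt n u) (splitAt n v)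
  ; irrefl = λ {u} → CRirr (splitAt n u)
  }

-- A linear ordering of V = Fin N is given by an injective (hence bijective)
-- position map pos : Fin N → Fin N; p precedes q iff pos p < pos q.
-- A partition into k classes is a surjective class map cls : Fin N → Fin k.
module _ {N : ℕ} (G : Graph N) {k : ℕ} (pos : Fin N → Fin N) (cls : Fin N → Fin k) where

  IndependentClasses : Set
  IndependentClasses = ∀ u v → Adj G u v → cls u ≢ cls v

  ConsecutiveClasses : Set
  ConsecutiveClasses = ∀ p q r → pos p < pos q → pos q < pos r →
    cls p ≡ cls r → cls q ≡ cls p

  Consistent : Set
  Consistent = ∀ p q r → pos p < pos q → pos q < pos r →
    cls p ≡ cls q → Adj G p r → Adj G q r

  ReverseConsistent : Set
  ReverseConsistent = ∀ p q r → pos r < pos q → pos q < pos p →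
    cls p ≡ cls q → Adj G p r → Adj G q r

ThinIndPrec : ∀ {N} → Graph N → ℕ → Set
ThinIndPrec {N} G k = ∃ λ (pos : Fin N → Fin N) → ∃ λ (cls : Fin N → Fin k) →
  Injective _≡_ _≡_ pos × Surjective _≡_ _≡_ cls ×
  IndependentClasses G pos cls × ConsecutiveClasses G pos cls × Consistent G pos cls

PThinIndPrec : ∀ {N} → Graph N → ℕ → Set
PThinIndPrec {N} G k = ∃ λ (pos : Fin N → Fin N) → ∃ λ (cls : Fin N → Fin k) →
  Injective _≡_ _≡_ pos × Surjective _≡_ _≡_ cls ×
  IndependentClasses G pos cls × ConsecutiveClasses G pos cls ×
  Consistent G pos cls × ReverseConsistent G pos cls

IsMinimum : (ℕ → Set) → ℕ → Set
IsMinimum P k = P k × (∀ j → P j → k ≤ j)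

thinIndPrec≡ : ∀ {N} → Graph N → ℕ → Set
thinIndPrec≡ G k = IsMinimum (ThinIndPrec G) k

pthinIndPrec≡ : ∀ {N} → Graph N → ℕ → Set
pthinIndPrec≡ G k = IsMinimum (PThinIndPrec G) k

{-# OPTIONS --safe #-}
-- For each index i let early i be whichever of a_i, b_i comes first and late i the other.
-- The classes of the early vertices are pairwise distinct: two of them on different sides are adjacent,
-- and if early i precedes early j on the same side then consistency fails at (early i, early j, late j).
-- One more class sits at the end of the ordering: the class of the last vertex z, unless that is also
-- the class of its partner, in which case the class of the last vertex whose index differs from z's.  Put a_i and b_i on levels i and i + 1, arranged so that every level lies on one side.
-- The n + 1 levels are then independent, and ordering by level, and within a level by decreasing index,
-- is strongly consistent.
module Submission where

open import Defs hiding (sym; irrefl)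
open import Data.Nat using (ℕ; zero; suc; _+_; _≤_; _<_; z≤n; s≤s)
open import Data.Nat.Properties
  using (≤-refl; ≤-reflexive; ≤-trans; ≤-antisym; <-irrefl; <-asym; <-trans; <-cmp; <⇒≤; <⇒≢; <⇒≱;
         ≤∧≢⇒<; ≤-pred; m≤n⇒m≤1+n; m<n⇒m<1+n; m≤n⇒m<n∨m≡n; suc-injective; <-strictTotalOrder; ≤-totalOrder;
         module ≤-Reasoning)
open import Data.Fin using (Fin; zero; suc; toℕ; fromℕ<; splitAt; join; punchIn; _≟_)
open import Data.Fin.Properties
  using (toℕ<n; toℕ-injective; toℕ-fromℕ<; fromℕ<-cong; fromℕ<-injective; splitAt-join; join-splitAt;
         punchInᵢ≢i; injective⇒≤)
open import Data.List using (List; []; _∷_; _++_; map; length; filter; allFin)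
open import Data.List.Properties using (filter-notAll; length-tabulate)
open import Data.List.Relation.Unary.Any using (Any; here; there)
open import Data.List.Relation.Unary.All as All using ()
open import Data.List.Relation.Unary.All.Properties using (all-filter)
open import Data.List.Membership.Propositional using (_∈_; lose)
open import Data.List.Membership.Propositional.Properties using (∈-filter⁺; ∈-allFin; ∈-map⁺; ∈-++⁺ˡ; ∈-++⁺ʳ)
open import Data.List.Extrema ≤-totalOrder using (argmax; argmax-all; f[xs]≤f[argmax])
open import Data.Product using (_×_; _,_; proj₁; proj₂; ∃)
open import Data.Product.Relation.Binary.Lex.Strict using (×-strictTotalOrder)
open import Data.Sum using (_⊎_; inj₁; inj₂; swap; reduce)
open import Data.Empty using (⊥-elim)
open import Function using (_∘_; id)
open import Function.Definitions using (Injective)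
open import Relation.Binary using (StrictTotalOrder; tri<; tri≈; tri>)
import Relation.Binary.Construct.Flip.EqAndOrd as Flip
open import Relation.Binary.PropositionalEquality
  using (_≡_; _≢_; refl; sym; trans; cong; subst; subst₂; module ≡-Reasoning)
open import Relation.Nullary using (¬_; ¬?; yes; no; contradiction)
open import Relation.Unary using (Pred; Decidable; _⊆_)

module _ {a p q} {A : Set a} {P : Pred A p} {Q : Pred A q}
         (P? : Decidable P) (Q? : Decidable Q) (P⊆Q : P ⊆ Q) where

  length-filter-mono : ∀ xs → length (filter P? xs) ≤ length (filter Q? xs)
  length-filter-mono []       = z≤n
  length-filter-mono (x ∷ xs) with P? x | Q? x
  ... | yes _  | yes _  = s≤s (length-filter-mono xs)
  ... | yes px | no ¬qx = contradiction (P⊆Q px) ¬qx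
  ... | no _   | yes _  = m≤n⇒m≤1+n (length-filter-mono xs)
  ... | no _   | no _   = length-filter-mono xs

  length-filter-< : ∀ {xs} → Any (λ x → Q x × ¬ P x) xs →
                    length (filter P? xs) < length (filter Q? xs)
  length-filter-< {x ∷ xs} (here (qx , ¬px)) with P? x | Q? x
  ... | yes px | _      = contradiction px ¬px
  ... | no _   | yes _  = s≤s (length-filter-mono xs)
  ... | no _   | no ¬qx = contradiction qx ¬qx
  length-filter-< {x ∷ xs} (there any) with P? x | Q? x
  ... | yes _  | yes _  = s≤s (length-filter-< any)
  ... | yes px | no ¬qx = contradiction (P⊆Q px) ¬qx
  ... | no _   | yes _  = m<n⇒m<1+n (length-filter-< any)
  ... | no _   | no _   = length-filter-< any

module _ {a p} {A : Set a} (f : A → ℕ) {Q : Pred A p} (Q? : Decidable Q) where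

  argmax-where : ∀ xs {x₀} → Q x₀ → ∃ λ z → Q z × (∀ {y} → y ∈ xs → Q y → f y ≤ f z)
  argmax-where xs {x₀} qx₀ =
    z , argmax-all f qx₀ (all-filter Q? xs) ,
    λ y∈xs qy → All.lookup (f[xs]≤f[argmax] x₀ (filter Q? xs)) (∈-filter⁺ Q? y∈xs qy)
    where
    z = argmax f x₀ (filter Q? xs)

module Ranking {a ℓ₁ ℓ₂} (O : StrictTotalOrder a ℓ₁ ℓ₂) {N : ℕ}
               (key : Fin N → StrictTotalOrder.Carrier O)
               (key-injective : Injective _≡_ (StrictTotalOrder._≈_ O) key) where

  open StrictTotalOrder O using (compare; irrefl; _<?_) renaming (_<_ to _⊏_; trans to ⊏-trans)
  open StrictTotalOrder.Eq O using () renaming (refl to ≈-refl)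

  rank : Fin N → ℕ
  rank v = length (filter (λ w → key w <? key v) (allFin N))

  rank<N : ∀ v → rank v < N
  rank<N v = subst (rank v <_) (length-tabulate id)
    (filter-notAll (λ w → key w <? key v) (allFin N) (lose (∈-allFin v) (irrefl ≈-refl)))

  rank-mono : ∀ {u v} → key u ⊏ key v → rank u < rank v
  rank-mono {u} {v} u⊏v =
    length-filter-< (λ w → key w <? key u) (λ w → key w <? key v) (λ w⊏u → ⊏-trans w⊏u u⊏v)
      (lose {P = λ w → key w ⊏ key v × ¬ key w ⊏ key u} (∈-allFin u) (u⊏v , irrefl ≈-refl))

  rank-injective : ∀ {u v} → rank u ≡ rank v → u ≡ v
  rank-injective {u} {v} eq with compare (key u) (key v)
  ... | tri< u⊏v _ _ = contradiction eq (<⇒≢ (rank-mono u⊏v))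
  ... | tri≈ _ u≈v _ = key-injective u≈v
  ... | tri> _ _ v⊏u = contradiction (sym eq) (<⇒≢ (rank-mono v⊏u))

  rank-reflects : ∀ {u v} → rank u < rank v → key u ⊏ key v
  rank-reflects {u} {v} lt with compare (key u) (key v)
  ... | tri< u⊏v _ _ = u⊏v
  ... | tri≈ _ u≈v _ = contradiction lt (<-irrefl (cong rank (key-injective u≈v)))
  ... | tri> _ _ v⊏u = contradiction lt (<-asym (rank-mono v⊏u))

  position : Fin N → Fin N
  position v = fromℕ< (rank<N v)

  position-injective : Injective _≡_ _≡_ position
  position-injective {u} {v} = rank-injective ∘ fromℕ<-injective (rank u) (rank v) (rank<N u) (rank<N v)

  position-reflects : ∀ {u v} → toℕ (position u) < toℕ (position v) → key u ⊏ key v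
  position-reflects {u} {v} = rank-reflects ∘ subst₂ _<_ (toℕ-fromℕ< (rank<N u)) (toℕ-fromℕ< (rank<N v))

pthin⇒thin : ∀ {N} {G : Graph N} {k} → PThinIndPrec G k → ThinIndPrec G k
pthin⇒thin (pos , cls , inj , surj , ind , cons , cst , _) = pos , cls , inj , surj , ind , cons , cst

minimum-of-pthin : ∀ {N} {G : Graph N} {k} → PThinIndPrec G k → (∀ j → ThinIndPrec G j → k ≤ j) →
                   thinIndPrec≡ G k × pthinIndPrec≡ G k
minimum-of-pthin {G = G} p lower = (pthin⇒thin {G = G} p , lower) , (p , λ j → lower j ∘ pthin⇒thin {G = G})

thin-positive : ∀ {N} {G : Graph (suc N)} {k} → ThinIndPrec G k → 1 ≤ k
thin-positive (_ , cls , _) = ≤-trans (s≤s z≤n) (toℕ<n (cls zero))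

edgeless-pthin : ∀ {N} (G : Graph (suc N)) → (∀ u v → ¬ Adj G u v) → PThinIndPrec G 1
edgeless-pthin G edgeless =
  id , (λ _ → zero) , id , (λ { zero → zero , λ _ → refl }) ,
  (λ u v uv _ → edgeless u v uv) , (λ _ _ _ _ _ _ → refl) ,
  (λ p _ r _ _ _ pr → ⊥-elim (edgeless p r pr)) , (λ p _ r _ _ _ pr → ⊥-elim (edgeless p r pr))

splitAt-injective : ∀ m {n} {i j : Fin (m + n)} → splitAt m i ≡ splitAt m j → i ≡ j
splitAt-injective m {n} {i} {j} eq =
  trans (sym (join-splitAt m n i)) (trans (cong (join m n) eq) (join-splitAt m n j))

join-injective : ∀ m n {u v : Fin m ⊎ Fin n} → join m n u ≡ join m n v → u ≡ v
join-injective m n {u} {v} eq =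
  trans (sym (splitAt-join m n u)) (trans (cong (splitAt m) eq) (splitAt-join m n v))

Vertex : ℕ → Set
Vertex n = Fin n ⊎ Fin n

index : ∀ {n} → Vertex n → Fin n
index = reduce

vertices : ∀ n → List (Vertex n)
vertices n = map inj₁ (allFin n) ++ map inj₂ (allFin n)

∈-vertices : ∀ {n} (v : Vertex n) → v ∈ vertices n
∈-vertices (inj₁ i) = ∈-++⁺ˡ (∈-map⁺ inj₁ (∈-allFin i))
∈-vertices {n} (inj₂ i) = ∈-++⁺ʳ (map inj₁ (allFin n)) (∈-map⁺ inj₂ (∈-allFin i))

index-swap : ∀ {n} (v : Vertex n) → index (swap v) ≡ index v
index-swap (inj₁ _) = refl
index-swap (inj₂ _) = refl

same-index : ∀ {n} (u v : Vertex n) → index u ≡ index v → u ≡ v ⊎ u ≡ swap v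
same-index (inj₁ _) (inj₁ _) refl = inj₁ refl
same-index (inj₁ _) (inj₂ _) refl = inj₂ refl
same-index (inj₂ _) (inj₁ _) refl = inj₂ refl
same-index (inj₂ _) (inj₂ _) refl = inj₁ refl

¬adj-swap : ∀ {n} (v : Vertex n) → ¬ CRAdj' v (swap v)
¬adj-swap (inj₁ _) ne = ne refl
¬adj-swap (inj₂ _) ne = ne refl

adj-or-adj-swap : ∀ {n} (u v : Vertex n) → index u ≢ index v → CRAdj' u v ⊎ CRAdj' u (swap v)
adj-or-adj-swap (inj₁ _) (inj₁ _) ne = inj₂ ne
adj-or-adj-swap (inj₁ _) (inj₂ _) ne = inj₁ ne
adj-or-adj-swap (inj₂ _) (inj₁ _) ne = inj₁ ne
adj-or-adj-swap (inj₂ _) (inj₂ _) ne = inj₂ ne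

adj⇒¬adj-swap : ∀ {n} (u v : Vertex n) → CRAdj' u v → ¬ CRAdj' u (swap v)
adj⇒¬adj-swap (inj₁ _) (inj₂ _) _ ()
adj⇒¬adj-swap (inj₂ _) (inj₁ _) _ ()

CR₁-edgeless : ∀ u v → ¬ Adj (CR 1) u v
CR₁-edgeless u v = edgeless (splitAt 1 u) (splitAt 1 v)
  where
  edgeless : ∀ (u v : Vertex 1) → ¬ CRAdj' u v
  edgeless (inj₁ zero) (inj₂ zero) ne = ne refl
  edgeless (inj₂ zero) (inj₁ zero) ne = ne refl

other-index : ∀ {n} → 2 ≤ n → (m : Fin n) → ∃ λ j → j ≢ m
other-index (s≤s (s≤s _)) m = punchIn m zero , punchInᵢ≢i m zero

-- Level c consists of a_(c-1) and a_c if c is even, and of b_(c-1) and b_c if c is odd.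
level : ∀ {n} → Vertex n → ℕ
level (inj₁ zero)    = 0
level (inj₂ zero)    = 1
level (inj₁ (suc i)) = suc (level (inj₂ i))
level (inj₂ (suc i)) = suc (level (inj₁ i))

index≤level : ∀ {n} (v : Vertex n) → toℕ (index v) ≤ level v
index≤level (inj₁ zero)    = z≤n
index≤level (inj₂ zero)    = z≤n
index≤level (inj₁ (suc i)) = s≤s (index≤level (inj₂ i))
index≤level (inj₂ (suc i)) = s≤s (index≤level (inj₁ i))

level≤suc-index : ∀ {n} (v : Vertex n) → level v ≤ suc (toℕ (index v))
level≤suc-index (inj₁ zero)    = z≤n
level≤suc-index (inj₂ zero)    = ≤-refl
level≤suc-index (inj₁ (suc i)) = s≤s (level≤suc-index (inj₂ i))
level≤suc-index (inj₂ (suc i)) = s≤s (level≤suc-index (inj₁ i))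

level<suc : ∀ {n} (v : Vertex n) → level v < suc n
level<suc v = s≤s (≤-trans (level≤suc-index v) (toℕ<n (index v)))

level-inj₁≢level-inj₂ : ∀ {n} (i j : Fin n) → level (inj₁ i) ≢ level (inj₂ j)
level-inj₁≢level-inj₂ zero          zero    ()
level-inj₁≢level-inj₂ zero          (suc j) ()
level-inj₁≢level-inj₂ (suc zero)    zero    ()
level-inj₁≢level-inj₂ (suc (suc i)) zero    ()
level-inj₁≢level-inj₂ (suc i)       (suc j) eq = level-inj₁≢level-inj₂ j i (sym (suc-injective eq))

level-suc-index : ∀ {n} (i : Fin n) → level (inj₁ i) ≡ suc (toℕ i) ⊎ level (inj₂ i) ≡ suc (toℕ i)
level-suc-index zero = inj₂ refl
level-suc-index (suc i) with level-suc-index i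
... | inj₁ eq = inj₂ (cong suc eq)
... | inj₂ eq = inj₁ (cong suc eq)

level-surjective : ∀ {n} → 1 ≤ n → ∀ c → c ≤ n → ∃ λ (v : Vertex n) → level v ≡ c
level-surjective (s≤s _) zero    _   = inj₁ zero , refl
level-surjective _       (suc c) c<n with level-suc-index (fromℕ< c<n)
... | inj₁ eq = inj₁ (fromℕ< c<n) , trans eq (cong suc (toℕ-fromℕ< c<n))
... | inj₂ eq = inj₂ (fromℕ< c<n) , trans eq (cong suc (toℕ-fromℕ< c<n))

adj⇒level≢ : ∀ {n} (u v : Vertex n) → CRAdj' u v → level u ≢ level v
adj⇒level≢ (inj₁ i) (inj₂ j) _ = level-inj₁≢level-inj₂ i j
adj⇒level≢ (inj₂ i) (inj₁ j) _ = level-inj₁≢level-inj₂ j i ∘ sym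

same-level-adj : ∀ {n} (p q r : Vertex n) → level p ≡ level q → index q ≢ index r → CRAdj' p r → CRAdj' q r
same-level-adj (inj₁ _) (inj₁ _) (inj₂ _) _  ne _  = ne
same-level-adj (inj₂ _) (inj₂ _) (inj₁ _) _  ne _  = ne
same-level-adj (inj₁ i) (inj₂ j) _        eq _  _  = contradiction eq (level-inj₁≢level-inj₂ i j)
same-level-adj (inj₂ i) (inj₁ j) _        eq _  _  = contradiction (sym eq) (level-inj₁≢level-inj₂ j i)

level-index-injective : ∀ {n} (u v : Vertex n) → level u ≡ level v → index u ≡ index v → u ≡ v
level-index-injective (inj₁ _) (inj₁ _) _  eq = cong inj₁ eq
level-index-injective (inj₂ _) (inj₂ _) _  eq = cong inj₂ eq
level-index-injective (inj₁ i) (inj₂ j) eq _  = contradiction eq (level-inj₁≢level-inj₂ i j)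
level-index-injective (inj₂ i) (inj₁ j) eq _  = contradiction (sym eq) (level-inj₁≢level-inj₂ j i)

levelOrder : StrictTotalOrder _ _ _
levelOrder = ×-strictTotalOrder <-strictTotalOrder (Flip.strictTotalOrder <-strictTotalOrder)

module _ {n : ℕ} where

  open StrictTotalOrder levelOrder using (_≈_) renaming (_<_ to _⊏_)

  levelKey : Vertex n → ℕ × ℕ
  levelKey v = level v , toℕ (index v)

  _⋖_ : Vertex n → Vertex n → Set
  u ⋖ v = levelKey u ⊏ levelKey v

  levelKey-injective : Injective _≡_ _≈_ levelKey
  levelKey-injective {u} {v} (eq , eq′) = level-index-injective u v eq (toℕ-injective eq′)

  ⋖⇒level≤ : ∀ {u v} → u ⋖ v → level u ≤ level v
  ⋖⇒level≤ (inj₁ lt)       = <⇒≤ lt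
  ⋖⇒level≤ (inj₂ (eq , _)) = ≤-reflexive eq

  same-level-⋖ : ∀ {u v} → level u ≡ level v → u ⋖ v → toℕ (index v) < toℕ (index u)
  same-level-⋖ eq (inj₁ lt)       = contradiction eq (<⇒≢ lt)
  same-level-⋖ _  (inj₂ (_ , lt)) = lt

  ⋖-consecutive : ∀ {p q r} → p ⋖ q → q ⋖ r → level p ≡ level r → level q ≡ level p
  ⋖-consecutive p⋖q q⋖r eq = ≤-antisym (≤-trans (⋖⇒level≤ q⋖r) (≤-reflexive (sym eq))) (⋖⇒level≤ p⋖q)

  ⋖-consistent : ∀ p q r → p ⋖ q → q ⋖ r → level p ≡ level q → CRAdj' p r → CRAdj' q r
  ⋖-consistent p q r p⋖q q⋖r eq = same-level-adj p q r eq (index≢ q⋖r)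
    where
    open ≤-Reasoning
    index≢ : q ⋖ r → index q ≢ index r
    index≢ (inj₂ (_ , lt)) = <⇒≢ lt ∘ sym ∘ cong toℕ
    index≢ (inj₁ lt)       = <⇒≢ (≤-pred (begin-strict
      suc (toℕ (index q))  ≤⟨ same-level-⋖ eq p⋖q ⟩
      toℕ (index p)        ≤⟨ index≤level p ⟩
      level p              ≡⟨ eq ⟩
      level q              <⟨ lt ⟩
      level r              ≤⟨ level≤suc-index r ⟩
      suc (toℕ (index r))  ∎)) ∘ cong toℕ

  ⋖-reverse-consistent : ∀ p q r → r ⋖ q → q ⋖ p → level p ≡ level q → CRAdj' p r → CRAdj' q r
  ⋖-reverse-consistent p q r r⋖q q⋖p eq = same-level-adj p q r eq (index≢ r⋖q)
    where
    open ≤-Reasoning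
    index≢ : r ⋖ q → index q ≢ index r
    index≢ (inj₂ (_ , lt)) = <⇒≢ lt ∘ cong toℕ
    index≢ (inj₁ lt)       = <⇒≢ (begin-strict
      toℕ (index r)        ≤⟨ index≤level r ⟩
      level r              <⟨ lt ⟩
      level q              ≡⟨ sym eq ⟩
      level p              ≤⟨ level≤suc-index p ⟩
      suc (toℕ (index p))  ≤⟨ same-level-⋖ (sym eq) q⋖p ⟩
      toℕ (index q)        ∎) ∘ sym ∘ cong toℕ

crown-pthin : ∀ {n} → 1 ≤ n → PThinIndPrec (CR n) (suc n)
crown-pthin {n} 1≤n =
  position , cls , position-injective , cls-surjective ,
  (λ u v uv → adj⇒level≢ (splitAt n u) (splitAt n v) uv ∘ cls-level) ,
  (λ p q r p<q q<r → level-cls ∘ ⋖-consecutive (position-reflects p<q) (position-reflects q<r) ∘ cls-level) ,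
  (λ p q r p<q q<r → ⋖-consistent (splitAt n p) (splitAt n q) (splitAt n r)
                       (position-reflects p<q) (position-reflects q<r) ∘ cls-level) ,
  (λ p q r r<q q<p → ⋖-reverse-consistent (splitAt n p) (splitAt n q) (splitAt n r)
                       (position-reflects r<q) (position-reflects q<p) ∘ cls-level)
  where
  key : Fin (n + n) → ℕ × ℕ
  key = levelKey ∘ splitAt n

  open Ranking levelOrder key (splitAt-injective n ∘ levelKey-injective)

  vertexLevel : Fin (n + n) → ℕ
  vertexLevel u = level (splitAt n u)

  cls : Fin (n + n) → Fin (suc n)
  cls u = fromℕ< (level<suc (splitAt n u))

  cls-level : ∀ {u v} → cls u ≡ cls v → vertexLevel u ≡ vertexLevel v
  cls-level {u} {v} = fromℕ<-injective _ _ (level<suc (splitAt n u)) (level<suc (splitAt n v))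

  level-cls : ∀ {u v} → vertexLevel u ≡ vertexLevel v → cls u ≡ cls v
  level-cls {u} {v} eq = fromℕ<-cong _ _ eq (level<suc (splitAt n u)) (level<suc (splitAt n v))

  cls-surjective : ∀ c → ∃ λ u → ∀ {w} → w ≡ u → cls w ≡ c
  cls-surjective c with level-surjective 1≤n (toℕ c) (≤-pred (toℕ<n c))
  ... | v , level≡c = join n n v , λ { refl → toℕ-injective (begin
    toℕ (cls (join n n v))          ≡⟨ toℕ-fromℕ< (level<suc (splitAt n (join n n v))) ⟩
    level (splitAt n (join n n v))  ≡⟨ cong level (splitAt-join n n v) ⟩
    level v                         ≡⟨ level≡c ⟩
    toℕ c                           ∎) }
    where open ≡-Reasoning

record Layout (n k : ℕ) : Set where
  field
    pos           : Vertex n → ℕ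
    pos-injective : Injective _≡_ _≡_ pos
    cls           : Vertex n → Fin k
    independent   : ∀ u v → CRAdj' u v → cls u ≢ cls v
    consecutive   : ∀ p q r → pos p < pos q → pos q < pos r → cls p ≡ cls r → cls q ≡ cls p
    consistent    : ∀ p q r → pos p < pos q → pos q < pos r → cls p ≡ cls q → CRAdj' p r → CRAdj' q r

layout-of-thin : ∀ {n k} → ThinIndPrec (CR n) k → Layout n k
layout-of-thin {n} (pos , cls , pos-injective , _ , independent , consecutive , consistent) = record
  { pos           = toℕ ∘ pos ∘ join n n
  ; pos-injective = join-injective n n ∘ pos-injective ∘ toℕ-injective
  ; cls           = cls ∘ join n n
  ; independent   = λ u v → independent (join n n u) (join n n v) ∘ to-join
  ; consecutive   = λ p q r → consecutive (join n n p) (join n n q) (join n n r)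
  ; consistent    = λ p q r p<q q<r pq →
                      from-join ∘ consistent (join n n p) (join n n q) (join n n r) p<q q<r pq ∘ to-join
  }
  where
  to-join : ∀ {u v} → CRAdj' u v → Adj (CR n) (join n n u) (join n n v)
  to-join {u} {v} = subst₂ CRAdj' (sym (splitAt-join n n u)) (sym (splitAt-join n n v))
  from-join : ∀ {u v} → Adj (CR n) (join n n u) (join n n v) → CRAdj' u v
  from-join {u} {v} = subst₂ CRAdj' (splitAt-join n n u) (splitAt-join n n v)

module LowerBound {n k} (2≤n : 2 ≤ n) (L : Layout n k) where

  open Layout L

  orientation : ∀ i → ∃ λ v → index v ≡ i × pos v < pos (swap v)
  orientation i with <-cmp (pos (inj₁ i)) (pos (inj₂ i))
  ... | tri< lt _ _ = inj₁ i , refl , lt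
  ... | tri≈ _ eq _ = contradiction (pos-injective eq) λ ()
  ... | tri> _ _ gt = inj₂ i , refl , gt

  early late : Fin n → Vertex n
  early i = proj₁ (orientation i)
  late i  = swap (early i)

  index-early : ∀ i → index (early i) ≡ i
  index-early i = proj₁ (proj₂ (orientation i))

  index-late : ∀ i → index (late i) ≡ i
  index-late i = trans (index-swap (early i)) (index-early i)

  early<late : ∀ i → pos (early i) < pos (late i)
  early<late i = proj₂ (proj₂ (orientation i))

  classmates-of-pair : ∀ w v → index w ≢ index v → cls w ≡ cls v → cls w ≢ cls (swap v)
  classmates-of-pair w v ne w∼v w∼v′ with adj-or-adj-swap w v ne
  ... | inj₁ adj = independent w v adj w∼v
  ... | inj₂ adj = independent w (swap v) adj w∼v′

  index-early≢ : ∀ {i j} → i ≢ j → index (early i) ≢ index (early j)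
  index-early≢ {i} {j} i≢j eq = i≢j (trans (sym (index-early i)) (trans eq (index-early j)))

  early-classes-distinct : ∀ {i j} → i ≢ j → pos (early i) < pos (early j) → cls (early i) ≢ cls (early j)
  early-classes-distinct {i} {j} i≢j lt with adj-or-adj-swap (early i) (early j) (index-early≢ i≢j)
  ... | inj₁ adj = independent (early i) (early j) adj
  ... | inj₂ adj = λ eq → ¬adj-swap (early j) (consistent (early i) (early j) (late j) lt (early<late j) eq adj)

  early-class-injective : ∀ {i j} → cls (early i) ≡ cls (early j) → i ≡ j
  early-class-injective {i} {j} eq with i ≟ j
  ... | yes i≡j = i≡j
  ... | no i≢j with <-cmp (pos (early i)) (pos (early j))
  ...   | tri< lt _ _ = contradiction eq (early-classes-distinct i≢j lt)
  ...   | tri≈ _ e _  = trans (sym (index-early i)) (trans (cong index (pos-injective e)) (index-early j))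
  ...   | tri> _ _ gt = contradiction (sym eq) (early-classes-distinct (i≢j ∘ sym) gt)

  after-late⇒index≢ : ∀ {j v} → pos (late j) < pos v → index v ≢ index (early j)
  after-late⇒index≢ {j} {v} lt eq with same-index v (early j) eq
  ... | inj₁ refl = <-asym (early<late j) lt
  ... | inj₂ refl = <-irrefl refl lt

  ¬classmate-after-late : ∀ {j v} → pos (late j) < pos v → cls v ≢ cls (early j)
  ¬classmate-after-late {j} {v} lt eq =
    classmates-of-pair v (early j) (after-late⇒index≢ lt) eq
      (trans eq (sym (consecutive (early j) (late j) v (early<late j) lt (sym eq))))

  -- early j is adjacent to early i or to late i, and consistency would make late j adjacent to it too.
  pair-split-before : ∀ {i j} → j ≢ i → pos (late j) < pos (early i) → cls (early j) ≢ cls (late j)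
  pair-split-before {i} {j} j≢i lt eq with adj-or-adj-swap (early j) (early i) (index-early≢ j≢i)
  ... | inj₁ adj = adj⇒¬adj-swap (early i) (early j) (CRsym (early j) (early i) adj)
                     (CRsym (late j) (early i) (consistent (early j) (late j) (early i) (early<late j) lt eq adj))
  ... | inj₂ adj = adj⇒¬adj-swap (late i) (early j) (CRsym (early j) (late i) adj)
                     (CRsym (late j) (late i) (consistent (early j) (late j) (late i) (early<late j)
                       (<-trans lt (early<late i)) eq adj))

  last-where : ∀ {ℓ} {Q : Pred (Vertex n) ℓ} → Decidable Q → ∀ {v₀} → Q v₀ →
               ∃ λ z → Q z × (∀ y → Q y → pos y ≤ pos z)
  last-where Q? qv₀ with argmax-where pos Q? (vertices n) qv₀
  ... | z , qz , maximal = z , qz , λ y → maximal (∈-vertices y)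

  z : Vertex n
  z = argmax pos (inj₁ (fromℕ< 2≤n)) (vertices n)

  z-last : ∀ y → pos y ≤ pos z
  z-last y = All.lookup (f[xs]≤f[argmax] _ (vertices n)) (∈-vertices y)

  m : Fin n
  m = index z

  before-last : ∀ {v} → index v ≢ m → pos v < pos z
  before-last {v} v≢m = ≤∧≢⇒< (z-last v) (v≢m ∘ cong index ∘ pos-injective)

  index-late≢ : ∀ {i j} → i ≢ j → index (late i) ≢ j
  index-late≢ {i} i≢j = i≢j ∘ trans (sym (index-late i))

  z≡late : z ≡ late m
  z≡late with same-index z (early m) (sym (index-early m))
  ... | inj₁ z≡early = contradiction (subst (λ v → pos (late m) ≤ pos v) z≡early (z-last (late m)))
                                     (<⇒≱ (early<late m))
  ... | inj₂ z≡late = z≡late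

  module LastPairClassmates (early∼late : cls (early m) ≡ cls (late m)) where

    last-other : ∃ λ w → index w ≢ m × (∀ y → index y ≢ m → pos y ≤ pos w)
    last-other = last-where (λ v → ¬? (index v ≟ m)) {inj₁ j} j≢m
      where
      j = proj₁ (other-index 2≤n m)
      j≢m = proj₂ (other-index 2≤n m)

    w : Vertex n
    w = proj₁ last-other

    w≢m : index w ≢ m
    w≢m = proj₁ (proj₂ last-other)

    ¬classmate-early-m : cls w ≢ cls (early m)
    ¬classmate-early-m eq =
      classmates-of-pair w (early m) (w≢m ∘ λ e → trans e (index-early m)) eq (trans eq early∼late)

    w<early : pos w < pos (early m)
    w<early with <-cmp (pos w) (pos (early m))
    ... | tri< lt _ _ = lt
    ... | tri≈ _ eq _ = contradiction (trans (cong index (pos-injective eq)) (index-early m)) w≢m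
    ... | tri> _ _ gt = contradiction (consecutive (early m) w (late m) gt w<late early∼late) ¬classmate-early-m
      where
      w<late : pos w < pos (late m)
      w<late = subst (λ v → pos w < pos v) z≡late (before-last w≢m)

    spare : ∀ j → cls w ≢ cls (early j)
    spare j eq with j ≟ m
    ... | yes refl = ¬classmate-early-m eq
    ... | no j≢m with m≤n⇒m<n∨m≡n (proj₂ (proj₂ last-other) (late j) (index-late≢ j≢m))
    ...   | inj₁ lt = ¬classmate-after-late lt eq
    ...   | inj₂ same = pair-split-before j≢m (subst (λ v → pos v < pos (early m)) (sym late≡w) w<early)
                          (trans (sym eq) (cong cls (sym late≡w)))
      where
      late≡w : late j ≡ w
      late≡w = pos-injective same

  spare-class : ∃ λ c → ∀ j → c ≢ cls (early j)
  spare-class with cls z ≟ cls (early m)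
  ... | yes z∼early = cls w , spare
    where open LastPairClassmates (trans (sym z∼early) (cong cls z≡late))
  ... | no z≁early = cls z , spare
    where
    spare : ∀ j → cls z ≢ cls (early j)
    spare j with j ≟ m
    ... | yes refl = z≁early
    ... | no j≢m = ¬classmate-after-late (before-last (index-late≢ j≢m))

  classes-lower-bound : suc n ≤ k
  classes-lower-bound = injective⇒≤ {f = classOf} classOf-injective
    where
    classOf : Fin (suc n) → Fin k
    classOf zero    = proj₁ spare-class
    classOf (suc i) = cls (early i)
    classOf-injective : Injective _≡_ _≡_ classOf
    classOf-injective {zero}  {zero}  _  = refl
    classOf-injective {zero}  {suc j} eq = contradiction eq (proj₂ spare-class j)
    classOf-injective {suc i} {zero}  eq = contradiction (sym eq) (proj₂ spare-class i)
    classOf-injective {suc i} {suc j} eq = cong suc (early-class-injective eq)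

thin-lower-bound : ∀ {n k} → 2 ≤ n → ThinIndPrec (CR n) k → suc n ≤ k
thin-lower-bound 2≤n = LowerBound.classes-lower-bound 2≤n ∘ layout-of-thin

theorem21 : ((n : ℕ) → 2 ≤ n → thinIndPrec≡ (CR n) (suc n) × pthinIndPrec≡ (CR n) (suc n))
    × (thinIndPrec≡ (CR 1) 1 × pthinIndPrec≡ (CR 1) 1)
theorem21 =
  (λ n 2≤n → minimum-of-pthin {G = CR n} (crown-pthin (≤-trans (s≤s z≤n) 2≤n)) (λ _ → thin-lower-bound 2≤n)) ,
  minimum-of-pthin {G = CR 1} (edgeless-pthin (CR 1) CR₁-edgeless) (λ _ → thin-positive {G = CR 1})
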